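{- Let $G$ be a 4-regular graph in which every vertex $v$ carries an eight-vertex constraint function with parameters $(a_v,b_v,c_v,d_v)$, and suppose at each vertex $v$ a weight function $w_v$ on signed pairings is fixed which is nonnegative, satisfies $a_v=w_v(\langle1\rangle_-)+w_v(\langle2\rangle_+)+w_v(\langle3\rangle_+)$, $b_v=w_v(\langle1\rangle_+)+w_v(\langle2\rangle_-)+w_v(\langle3\rangle_+)$, $c_v=w_v(\langle1\rangle_+)+w_v(\langle2\rangle_+)+w_v(\langle3\rangle_-)$, $d_v=w_v(\langle1\rangle_-)+w_v(\langle2\rangle_-)+w_v(\langle3\rangle_-)$, and satisfies $w_v(\langle1\rangle_+)\ge w_v(\langle1\rangle_-)$, $w_v(\langle2\rangle_+)\ge w_v(\langle2\rangle_-)$, $w_v(\langle3\rangle_+)\ge w_v(\langle3\rangle_-)$. Then at each vertex $v$ of $G$: $Z_v(\langle1\rangle_+)\ge Z_v(\langle1\rangle_-)$, $Z_v(\langle2\rangle_+)\ge Z_v(\langle2\rangle_-)$ and $Z_v(\langle3\rangle_+)\ge Z_v(\langle3\rangle_-)$.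
   Context: $G$ is a finite 4-regular graph (multiple edges and loops allowed); at each vertex the four incident edge-ends are labeled $e_1,e_2,e_3,e_4$. An eight-vertex constraint function with parameters $(a,b,c,d)\in\mathbb{R}_{\ge0}^4$ at a vertex assigns to a local orientation of $e_1,\dots,e_4$ (bit $i$ is $0$ if $e_i$ points in, $1$ if out) the value $a$ on $0011,1100$, $b$ on $0110,1001$, $c$ on $0101,1010$, $d$ on $0000,1111$, and $0$ otherwise. At a vertex, the three pairings are $\langle1\rangle=\{\{e_1,e_2\},\{e_3,e_4\}\}$, $\langle2\rangle=\{\{e_1,e_4\},\{e_2,e_3\}\}$, $\langle3\rangle=\{\{e_1,e_3\},\{e_2,e_4\}\}$; a signed pairing $\langle i\rangle_+$ or $\langle i\rangle_-$ is a pairing with a sign. Choosing a pairing at every vertex partitions the edges of $G$ into edge-disjoint closed circuits (walk through a vertex from an edge to the edge it is paired with). An annotated circuit partition (acp) is a choice of signed pairing at every vertex such that along every resulting circuit an even number of $-$ signs is encountered (a vertex visited twice by the same circuit with sign $-$ counts twice). A directed state of a circuit is an orientation of its edges such that at each vertex passage with sign $+$ the two consecutive edges form one-in-one-out at that vertex, and with sign $-$ they are both in or both out; each circuit of an acp has exactly two directed states. A directed acp (dacp) is an acp together with a directed state for each of its circuits. The weight of a dacp is $\prod_{v}w_v(\boldsymbol{\varrho}_v)$, where $\boldsymbol{\varrho}_v$ is its signed pairing at $v$. For a signed pairing $\boldsymbol{\varrho}$ at $v$, $Z_v(\boldsymbol{\varrho})$ is the sum of the weights of all dacp's of $G$ whose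 signed pairing at $v$ is $\boldsymbol{\varrho}$.
   Formalization: The weight functions $w_v$ and the parameters $(a_v,b_v,c_v,d_v)$ take values in the nonnegative rationals rather than the nonnegative reals. -}

module Defs where

open import Data.Nat as ℕ using (ℕ; zero; suc)
open import Data.Nat.Divisibility using (_∣_; _∣?_)
open import Data.Fin using (Fin; zero; suc; toℕ)
import Data.Fin.Properties as FinP
open import Data.Bool using (Bool; true; false; not)
import Data.Bool.Properties as BoolP
open import Data.Product using (_×_; _,_; proj₁; proj₂)
import Data.Product.Properties as ProdP
open import Data.List using (List; []; _∷_; map; foldr; filter; cartesianProduct; allFin; concatMap)
open import Data.Vec as Vec using (Vec; []; _∷_; lookup)
open import Data.Rational as ℚ using (ℚ; 0ℚ; 1ℚ)
open import Relation.Binary.PropositionalEquality using (_≡_; refl)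
open import Relation.Nullary using (¬_; Dec; yes; no)
open import Relation.Nullary.Decidable using (_×-dec_; _→-dec_)
open import Relation.Binary.Definitions using (DecidableEquality)

-- Signs and signed pairings.
-- Edge-ends e₁,e₂,e₃,e₄ at a vertex are Fin 4 = 0,1,2,3.
-- Pairings ⟨1⟩,⟨2⟩,⟨3⟩ are Fin 3 = 0,1,2.

data Sign : Set where
  plus minus : Sign

_≟Sign_ : DecidableEquality Sign
plus  ≟Sign plus  = yes refl
plus  ≟Sign minus = no λ ()
minus ≟Sign plus  = no λ ()
minus ≟Sign minus = yes refl

SignedPairing : Set
SignedPairing = Fin 3 × Sign

_≟SP_ : DecidableEquality SignedPairing
_≟SP_ = ProdP.≡-dec FinP._≟_ _≟Sign_

⟨_⟩₊ : Fin 3 → SignedPairing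
⟨ p ⟩₊ = p , plus

⟨_⟩₋ : Fin 3 → SignedPairing
⟨ p ⟩₋ = p , minus

allSP : List SignedPairing
allSP = cartesianProduct (allFin 3) (plus ∷ minus ∷ [])

-- partner p i : the edge-end paired with e_i under pairing ⟨p⟩
--   ⟨1⟩ = {{e₁,e₂},{e₃,e₄}}, ⟨2⟩ = {{e₁,e₄},{e₂,e₃}}, ⟨3⟩ = {{e₁,e₃},{e₂,e₄}}
partner : Fin 3 → Fin 4 → Fin 4
partner zero zero = suc zero
partner zero (suc zero) = zero
partner zero (suc (suc zero)) = suc (suc (suc zero))
partner zero (suc (suc (suc zero))) = suc (suc zero)
partner (suc zero) zero = suc (suc (suc zero))
partner (suc zero) (suc zero) = suc (suc zero)
partner (suc zero) (suc (suc zero)) = suc zero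
partner (suc zero) (suc (suc (suc zero))) = zero
partner (suc (suc zero)) zero = suc (suc zero)
partner (suc (suc zero)) (suc zero) = suc (suc (suc zero))
partner (suc (suc zero)) (suc (suc zero)) = zero
partner (suc (suc zero)) (suc (suc (suc zero))) = suc zero

-- Finite 4-regular graphs (loops and multi-edges allowed) with n vertices.
-- The edges are given by a fixed-point-free involution `other` on
-- half-edges, matching each edge-end with the other end of its edge.

HalfEdge : ℕ → Set
HalfEdge n = Fin n × Fin 4

record Graph4 (n : ℕ) : Set where
  field
    other       : HalfEdge n → HalfEdge n
    other-invol : ∀ h → other (other h) ≡ h
    other-nofix : ∀ h → ¬ (other h ≡ h)
open Graph4 public

-- Eight-vertex constraint function with parameters (a,b,c,d), evaluated
-- on a local orientation (x₁,x₂,x₃,x₄) (false = 0 = in, true = 1 = out).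

eightVertex : ℚ → ℚ → ℚ → ℚ → Bool → Bool → Bool → Bool → ℚ
eightVertex a b c d false false true  true  = a
eightVertex a b c d true  true  false false = a
eightVertex a b c d false true  true  false = b
eightVertex a b c d true  false false true  = b
eightVertex a b c d false true  false true  = c
eightVertex a b c d true  false true  false = c
eightVertex a b c d false false false false = d
eightVertex a b c d true  true  true  true  = d
eightVertex a b c d _     _     _     _     = 0ℚ

Orientation : ℕ → Set
Orientation n = Vec (Vec Bool 4) n

out : ∀ {n} → Orientation n → HalfEdge n → Bool
out o (v , i) = lookup (lookup o v) i

IsOrientation : ∀ {n} → Graph4 n → Orientation n → Set
IsOrientation G o = ∀ v i → out o (other G (v , i)) ≡ not (out o (v , i))

Assignment : ℕ → Set
Assignment n = Vec SignedPairing n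

-- Orbits of `step` are the circuits (with a direction);
-- each application of step is one passage through a vertex.

step : ∀ {n} → Graph4 n → Assignment n → HalfEdge n → HalfEdge n
step G s (v , i) = other G (v , partner (proj₁ (lookup s v)) i)

iter : ∀ {A : Set} → (A → A) → ℕ → A → A
iter f zero    x = x
iter f (suc k) x = iter f k (f x)

minusBit : Sign → ℕ
minusBit plus  = 0
minusBit minus = 1

minusCount : ∀ {n} → Graph4 n → Assignment n → HalfEdge n → ℕ → ℕ
minusCount G s h zero = 0
minusCount G s (v , i) (suc k) =
  minusBit (proj₂ (lookup s v)) ℕ.+ minusCount G s (step G s (v , i)) k

-- A circuit through h has length (its period under step) at most
-- the number 4n of half-edges, so it suffices to consider closing times
-- k+1 ≤ 4n; for k+1 a multiple of the period, evenness over k+1 steps is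
-- equivalent to evenness over one traversal.
IsACP : ∀ {n} → Graph4 n → Assignment n → Set
IsACP {n} G s = ∀ v i (k : Fin (4 ℕ.* n)) →
  iter (step G s) (suc (toℕ k)) (v , i) ≡ (v , i) →
  2 ∣ minusCount G s (v , i) (suc (toℕ k))

PassageOK : Sign → Bool → Bool → Set
PassageOK plus  x y = x ≡ not y
PassageOK minus x y = x ≡ y

-- A choice of directed state for every circuit of the acp s is the same
-- as an orientation of all edges satisfying the passage condition at
-- every passage (the circuits partition the edges).
IsDirected : ∀ {n} → Graph4 n → Assignment n → Orientation n → Set
IsDirected G s o =
  IsOrientation G o ×
  (∀ v i → PassageOK (proj₂ (lookup s v)) (out o (v , i))
                      (out o (v , partner (proj₁ (lookup s v)) i)))

IsDACP : ∀ {n} → Graph4 n → Assignment n × Orientation n → Set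
IsDACP G (s , o) = IsACP G s × IsDirected G s o

private
  passage? : ∀ sg x y → Dec (PassageOK sg x y)
  passage? plus  x y = x BoolP.≟ not y
  passage? minus x y = x BoolP.≟ y

  _≟HE_ : ∀ {n} → DecidableEquality (HalfEdge n)
  _≟HE_ = ProdP.≡-dec FinP._≟_ FinP._≟_

IsACP? : ∀ {n} (G : Graph4 n) s → Dec (IsACP G s)
IsACP? G s = FinP.all? λ v → FinP.all? λ i → FinP.all? λ k →
  (iter (step G s) (suc (toℕ k)) (v , i) ≟HE (v , i)) →-dec
  (2 ∣? minusCount G s (v , i) (suc (toℕ k)))

IsDirected? : ∀ {n} (G : Graph4 n) s o → Dec (IsDirected G s o)
IsDirected? G s o =
  (FinP.all? λ v → FinP.all? λ i →
     out o (other G (v , i)) BoolP.≟ not (out o (v , i)))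
  ×-dec
  (FinP.all? λ v → FinP.all? λ i →
     passage? (proj₂ (lookup s v)) (out o (v , i))
              (out o (v , partner (proj₁ (lookup s v)) i)))

IsDACP? : ∀ {n} (G : Graph4 n) p → Dec (IsDACP G p)
IsDACP? G (s , o) = IsACP? G s ×-dec IsDirected? G s o

allVecs : ∀ {A : Set} → List A → (n : ℕ) → List (Vec A n)
allVecs xs zero    = [] ∷ []
allVecs xs (suc n) = concatMap (λ x → map (x ∷_) (allVecs xs n)) xs

dacps : ∀ {n} → Graph4 n → List (Assignment n × Orientation n)
dacps {n} G = filter (IsDACP? G)
  (cartesianProduct (allVecs allSP n) (allVecs (allVecs (true ∷ false ∷ []) 4) n))

sumℚ : List ℚ → ℚ
sumℚ = foldr ℚ._+_ 0ℚ

prodℚ : List ℚ → ℚ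
prodℚ = foldr ℚ._*_ 1ℚ

weight : ∀ {n} → (Fin n → SignedPairing → ℚ) → Assignment n → ℚ
weight {n} w s = prodℚ (map (λ v → w v (lookup s v)) (allFin n))

Z : ∀ {n} → Graph4 n → (Fin n → SignedPairing → ℚ) → Fin n → SignedPairing → ℚ
Z G w v ϱ =
  sumℚ (map (λ p → weight w (proj₁ p))
            (filter (λ p → lookup (proj₁ p) v ≟SP ϱ) (dacps G)))

{-# OPTIONS --safe #-}
-- The difference Z_v(⟨p⟩₊) − Z_v(⟨p⟩₋) is itself a partition function: the one in which
-- the weight at v is replaced by Δ·w_v with Δ = [ϱ = ⟨p⟩₊] − [ϱ = ⟨p⟩₋].  A directed state
-- already forces every circuit to carry an even number of − signs, so such a partition
-- function is a sum over orientations of products of local signatures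
-- F_u(σ) = Σ_ϱ [σ is consistent with ϱ] W_u(ϱ).  Expanding each F_u in the characters of
-- the even subsets S of its four ends, twisted by (−1)^{|S|/2}, gives the coefficients
-- ¼ Σ_ϱ W(ϱ) and ¼ (W ⟨q⟩₊ − W ⟨q⟩₋), which are nonnegative whenever W ⟨q⟩₋ ≤ W ⟨q⟩₊ for
-- all q (as holds for Δ·w_v too).  Multiplying out, the partition function becomes a
-- nonnegative combination of character sums over orientations.  Such a sum vanishes when
-- the selected ends are not closed under the edge involution (reversing one edge flips the
-- sign of every term), and otherwise all its terms equal 1, since exactly half of the
-- selected ends point out.
module Submission where

open import Defs
open import Data.Nat using (ℕ)
open import Data.Fin using (Fin; zero; suc)
open import Data.Product using (_×_)
open import Data.Rational using (ℚ; 0ℚ; _≤_; _+_)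
open import Relation.Binary.PropositionalEquality using (_≡_)

open import Algebra.Bundles using (CommutativeSemiring; CommutativeRing)
open import Algebra.Structures using (IsCommutativeSemiring; IsCommutativeRing)
import Algebra.Properties.CommutativeSemigroup as CommutativeSemigroupProperties
open import Data.Bool using (Bool; true; false; not; _∧_; _∨_; _xor_; if_then_else_)
import Data.Bool.Properties as BoolP
open import Data.Empty using (⊥-elim)
open import Data.Fin using (toℕ)
import Data.Fin.Properties as FinP
open import Data.List
  using (List; []; _∷_; _++_; map; foldr; filter; allFin; cartesianProduct; cartesianProductWith; concatMap)
import Data.List.Properties as ListP
open import Data.Nat using (zero; suc)
import Data.Nat as ℕ
import Data.Nat.Properties as ℕP
open import Data.Nat.Divisibility using (_∣_; divides; ∣-refl; ∣m∣n⇒∣m+n)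
open import Data.Parity using (Parity; 0ℙ; 1ℙ)
import Data.Parity as ℙ
import Data.Parity.Properties as ℙP
open import Data.Product using (_,_; proj₁; proj₂; ∃; uncurry)
import Data.Product.Properties as ProdP
open import Data.Rational using (1ℚ; _*_; -_; _-_; ½; nonNegative)
import Data.Rational.Properties as ℚP
open import Data.Rational.Solver using (module +-*-Solver)
open import Data.Unit using (tt)
open import Data.Vec using (Vec; []; _∷_; lookup; _[_]%=_)
import Data.Vec.Properties as VecP
import Data.Vec.Functional as Vector
import Data.Vec.Functional.Properties as VectorP
open import Function using (id; _∘_; _⇔_; mk⇔)
open import Level using (0ℓ)
open import Relation.Binary.Definitions using (DecidableEquality)
open import Relation.Binary.PropositionalEquality
  using (_≢_; refl; sym; trans; cong; cong₂; cong-app; subst; module ≡-Reasoning)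
open import Relation.Nullary using (¬_; Dec; yes; no; does; map′; _×-dec_)
open import Relation.Nullary.Decidable using (from-yes; does-⇔)
open import Relation.Unary using (Decidable)

open +-*-Solver using (solve; _:=_; _:+_; _:*_; _:-_; :-_; con)
open import Algebra.Properties.Semiring.Exp (CommutativeRing.semiring ℚP.+-*-commutativeRing)
  using (_^_; ^-homo-*)

module FiniteSum {A : Set} {_+_ _*_ : A → A → A} {0# 1# : A}
                 (isCS : IsCommutativeSemiring _≡_ _+_ _*_ 0# 1#) where

  open IsCommutativeSemiring isCS
    using (+-assoc; +-identityˡ; +-identityʳ; *-assoc; *-comm; *-identityˡ; distribˡ; zeroˡ; zeroʳ)
  open ≡-Reasoning

  private
    semiring : CommutativeSemiring 0ℓ 0ℓ
    semiring = record { isCommutativeSemiring = isCS }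
    module + = CommutativeSemigroupProperties (CommutativeSemiring.+-commutativeSemigroup semiring)
    module * = CommutativeSemigroupProperties (CommutativeSemiring.*-commutativeSemigroup semiring)

    variable
      X Y : Set

  ∑ ∏ : List X → (X → A) → A
  ∑ xs f = foldr _+_ 0# (map f xs)
  ∏ xs f = foldr _*_ 1# (map f xs)

  ∑-cong : ∀ (xs : List X) {f g : X → A} → (∀ x → f x ≡ g x) → ∑ xs f ≡ ∑ xs g
  ∑-cong xs f≗g = cong (foldr _+_ 0#) (ListP.map-cong f≗g xs)

  ∏-cong : ∀ (xs : List X) {f g : X → A} → (∀ x → f x ≡ g x) → ∏ xs f ≡ ∏ xs g
  ∏-cong xs f≗g = cong (foldr _*_ 1#) (ListP.map-cong f≗g xs)

  ∑-map : ∀ (g : X → Y) xs f → ∑ (map g xs) f ≡ ∑ xs (f ∘ g)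
  ∑-map g xs f = cong (foldr _+_ 0#) (sym (ListP.map-∘ xs))

  ∑-++ : ∀ (xs ys : List X) f → ∑ (xs ++ ys) f ≡ ∑ xs f + ∑ ys f
  ∑-++ []       ys f = sym (+-identityˡ _)
  ∑-++ (x ∷ xs) ys f = trans (cong (f x +_) (∑-++ xs ys f)) (sym (+-assoc _ _ _))

  ∑-concatMap : ∀ (g : X → List Y) xs f → ∑ (concatMap g xs) f ≡ ∑ xs (λ x → ∑ (g x) f)
  ∑-concatMap g []       f = refl
  ∑-concatMap g (x ∷ xs) f =
    trans (∑-++ (g x) (concatMap g xs) f) (cong (∑ (g x) f +_) (∑-concatMap g xs f))

  ∑-cartesianProduct : ∀ (xs : List X) (ys : List Y) f →
    ∑ (cartesianProduct xs ys) f ≡ ∑ xs (λ x → ∑ ys (λ y → f (x , y)))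
  ∑-cartesianProduct []       ys f = refl
  ∑-cartesianProduct (x ∷ xs) ys f = trans (∑-++ (map (x ,_) ys) _ f)
    (cong₂ _+_ (∑-map (x ,_) ys f) (∑-cartesianProduct xs ys f))

  ∑-zero : ∀ (xs : List X) → ∑ xs (λ _ → 0#) ≡ 0#
  ∑-zero []       = refl
  ∑-zero (x ∷ xs) = trans (+-identityˡ _) (∑-zero xs)

  ∑-distrib-+ : ∀ (xs : List X) f g → ∑ xs (λ x → f x + g x) ≡ ∑ xs f + ∑ xs g
  ∑-distrib-+ []       f g = sym (+-identityˡ 0#)
  ∑-distrib-+ (x ∷ xs) f g =
    trans (cong ((f x + g x) +_) (∑-distrib-+ xs f g)) (+.interchange _ _ _ _)

  ∏-distrib-* : ∀ (xs : List X) f g → ∏ xs (λ x → f x * g x) ≡ ∏ xs f * ∏ xs g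
  ∏-distrib-* []       f g = sym (*-identityˡ 1#)
  ∏-distrib-* (x ∷ xs) f g =
    trans (cong ((f x * g x) *_) (∏-distrib-* xs f g)) (*.interchange _ _ _ _)

  *-distribˡ-∑ : ∀ c (xs : List X) f → c * ∑ xs f ≡ ∑ xs (λ x → c * f x)
  *-distribˡ-∑ c []       f = zeroʳ c
  *-distribˡ-∑ c (x ∷ xs) f = trans (distribˡ c _ _) (cong ((c * f x) +_) (*-distribˡ-∑ c xs f))

  *-distribʳ-∑ : ∀ c (xs : List X) f → ∑ xs f * c ≡ ∑ xs (λ x → f x * c)
  *-distribʳ-∑ c xs f = begin
    ∑ xs f * c            ≡⟨ *-comm _ c ⟩
    c * ∑ xs f            ≡⟨ *-distribˡ-∑ c xs f ⟩
    ∑ xs (λ x → c * f x)  ≡⟨ ∑-cong xs (λ x → *-comm c (f x)) ⟩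
    ∑ xs (λ x → f x * c)  ∎

  ∑-comm : ∀ (xs : List X) (ys : List Y) (f : X → Y → A) →
    ∑ xs (λ x → ∑ ys (f x)) ≡ ∑ ys (λ y → ∑ xs (λ x → f x y))
  ∑-comm []       ys f = sym (∑-zero ys)
  ∑-comm (x ∷ xs) ys f = trans (cong (∑ ys (f x) +_) (∑-comm xs ys f))
    (sym (∑-distrib-+ ys (f x) (λ y → ∑ xs (λ x → f x y))))

  ∑-allFin-suc : ∀ m (f : Fin (suc m) → A) → ∑ (allFin (suc m)) f ≡ f zero + ∑ (allFin m) (f ∘ suc)
  ∑-allFin-suc m f = cong (λ l → f zero + foldr _+_ 0# l)
    (trans (ListP.map-tabulate suc f) (sym (ListP.map-tabulate id (f ∘ suc))))

  ∏-allFin-suc : ∀ m (f : Fin (suc m) → A) → ∏ (allFin (suc m)) f ≡ f zero * ∏ (allFin m) (f ∘ suc)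
  ∏-allFin-suc m f = cong (λ l → f zero * foldr _*_ 1# l)
    (trans (ListP.map-tabulate suc f) (sym (ListP.map-tabulate id (f ∘ suc))))

  ∏-allFin-scale : ∀ m (f g : Fin m → A) u c → g u ≡ c * f u → (∀ u′ → u′ ≢ u → g u′ ≡ f u′) →
    ∏ (allFin m) g ≡ c * ∏ (allFin m) f
  ∏-allFin-scale (suc m) f g zero c gu others = begin
    ∏ (allFin (suc m)) g                   ≡⟨ ∏-allFin-suc m g ⟩
    g zero * ∏ (allFin m) (g ∘ suc)        ≡⟨ cong₂ _*_ gu (∏-cong (allFin m) (λ u → others (suc u) λ ())) ⟩
    (c * f zero) * ∏ (allFin m) (f ∘ suc)  ≡⟨ *-assoc c _ _ ⟩
    c * (f zero * ∏ (allFin m) (f ∘ suc))  ≡⟨ cong (c *_) (∏-allFin-suc m f) ⟨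
    c * ∏ (allFin (suc m)) f               ∎
  ∏-allFin-scale (suc m) f g (suc u) c gu others = begin
    ∏ (allFin (suc m)) g                   ≡⟨ ∏-allFin-suc m g ⟩
    g zero * ∏ (allFin m) (g ∘ suc)        ≡⟨ cong₂ _*_ (others zero λ ()) scaled ⟩
    f zero * (c * ∏ (allFin m) (f ∘ suc))  ≡⟨ *.x∙yz≈y∙xz (f zero) c _ ⟩
    c * (f zero * ∏ (allFin m) (f ∘ suc))  ≡⟨ cong (c *_) (∏-allFin-suc m f) ⟨
    c * ∏ (allFin (suc m)) f               ∎
    where
    scaled : ∏ (allFin m) (g ∘ suc) ≡ c * ∏ (allFin m) (f ∘ suc)
    scaled = ∏-allFin-scale m (f ∘ suc) (g ∘ suc) u c gu (λ u′ u′≢u → others (suc u′) (u′≢u ∘ FinP.suc-injective))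

  ∏-∑-allVecs : ∀ (L : List X) m (g : Fin m → X → A) →
    ∏ (allFin m) (λ u → ∑ L (g u)) ≡ ∑ (allVecs L m) (λ M → ∏ (allFin m) (λ u → g u (lookup M u)))
  ∏-∑-allVecs L zero    g = sym (+-identityʳ 1#)
  ∏-∑-allVecs L (suc m) g = begin
    ∏ (allFin (suc m)) (λ u → ∑ L (g u))
      ≡⟨ ∏-allFin-suc m _ ⟩
    ∑ L (g zero) * ∏ (allFin m) (λ u → ∑ L (g (suc u)))
      ≡⟨ cong (∑ L (g zero) *_) (∏-∑-allVecs L m (g ∘ suc)) ⟩
    ∑ L (g zero) * ∑ (allVecs L m) rest
      ≡⟨ *-distribʳ-∑ _ L (g zero) ⟩
    ∑ L (λ x → g zero x * ∑ (allVecs L m) rest)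
      ≡⟨ ∑-cong L (λ x → *-distribˡ-∑ (g zero x) (allVecs L m) rest) ⟩
    ∑ L (λ x → ∑ (allVecs L m) (λ M → g zero x * rest M))
      ≡⟨ ∑-cong L (λ x → trans (∑-cong (allVecs L m) (λ M → sym (∏-allFin-suc m (whole (x ∷ M)))))
                                (sym (∑-map (x ∷_) (allVecs L m) (λ M → ∏ (allFin (suc m)) (whole M))))) ⟩
    ∑ L (λ x → ∑ (map (x ∷_) (allVecs L m)) (λ M → ∏ (allFin (suc m)) (whole M)))
      ≡⟨ ∑-concatMap (λ x → map (x ∷_) (allVecs L m)) L _ ⟨
    ∑ (allVecs L (suc m)) (λ M → ∏ (allFin (suc m)) (whole M)) ∎
    where
    rest : Vec _ m → A
    rest M = ∏ (allFin m) (λ u → g (suc u) (lookup M u))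
    whole : Vec _ (suc m) → Fin (suc m) → A
    whole M u = g u (lookup M u)

  𝟙 : {P : Set} → Dec P → A
  𝟙 d = if does d then 1# else 0#

  𝟙-cong : {P Q : Set} → P ⇔ Q → (p : Dec P) (q : Dec Q) → 𝟙 p ≡ 𝟙 q
  𝟙-cong P⇔Q p q = cong (λ b → if b then 1# else 0#) (does-⇔ P⇔Q p q)

  𝟙-× : {P Q R : Set} → R ⇔ (P × Q) → (r : Dec R) (p : Dec P) (q : Dec Q) → 𝟙 r ≡ 𝟙 p * 𝟙 q
  𝟙-× R⇔P×Q r p q = trans (𝟙-cong R⇔P×Q r (p ×-dec q)) (product p q)
    where
    product : (p : Dec _) (q : Dec _) → 𝟙 (p ×-dec q) ≡ 𝟙 p * 𝟙 q
    product (yes _) (yes _) = sym (*-identityˡ 1#)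
    product (yes _) (no _)  = sym (zeroʳ 1#)
    product (no _)  q       = sym (zeroˡ (𝟙 q))

  𝟙-∀ : ∀ m {P : Fin m → Set} (P? : ∀ i → Dec (P i)) (d : Dec (∀ i → P i)) →
    𝟙 d ≡ ∏ (allFin m) (λ i → 𝟙 (P? i))
  𝟙-∀ zero    P? d = 𝟙-cong (mk⇔ _ (λ _ ())) d (yes tt)
  𝟙-∀ (suc m) {P} P? d = begin
    𝟙 d                                                ≡⟨ 𝟙-× ∀-split d (P? zero) all? ⟩
    𝟙 (P? zero) * 𝟙 all?                               ≡⟨ cong (𝟙 (P? zero) *_) (𝟙-∀ m (P? ∘ suc) all?) ⟩
    𝟙 (P? zero) * ∏ (allFin m) (λ i → 𝟙 (P? (suc i)))  ≡⟨ ∏-allFin-suc m (λ i → 𝟙 (P? i)) ⟨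
    ∏ (allFin (suc m)) (λ i → 𝟙 (P? i))                ∎
    where
    all? : Dec (∀ i → P (suc i))
    all? = FinP.all? (P? ∘ suc)
    ∀-split : (∀ i → P i) ⇔ (P zero × ∀ i → P (suc i))
    ∀-split = mk⇔ (λ h → h zero , h ∘ suc) (uncurry FinP.∀-cons)

  ∑-filter : ∀ {P : X → Set} (P? : Decidable P) xs f →
    ∑ (filter P? xs) f ≡ ∑ xs (λ x → 𝟙 (P? x) * f x)
  ∑-filter P? []       f = refl
  ∑-filter P? (x ∷ xs) f with P? x
  ... | yes _ = cong₂ _+_ (sym (*-identityˡ (f x))) (∑-filter P? xs f)
  ... | no _  = begin
    ∑ (filter P? xs) f                          ≡⟨ ∑-filter P? xs f ⟩
    ∑ xs (λ x → 𝟙 (P? x) * f x)                 ≡⟨ +-identityˡ _ ⟨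
    0# + ∑ xs (λ x → 𝟙 (P? x) * f x)            ≡⟨ cong (_+ ∑ xs (λ x → 𝟙 (P? x) * f x)) (zeroˡ (f x)) ⟨
    (0# * f x) + ∑ xs (λ x → 𝟙 (P? x) * f x)    ∎

  -- The Kronecker delta sifts over L: L lists every element of X exactly once.
  record IsEnumeration {X : Set} (_≟_ : DecidableEquality X) (L : List X) : Set where
    field
      sift : ∀ a (g : X → A) → ∑ L (λ x → 𝟙 (x ≟ a) * g x) ≡ g a
  open IsEnumeration public

  ∑-involution : ∀ {_≟_ : DecidableEquality X} {L} → IsEnumeration _≟_ L →
    (π : X → X) → (∀ x → π (π x) ≡ x) → ∀ f → ∑ L (f ∘ π) ≡ ∑ L f
  ∑-involution {_≟_ = _≟_} {L} enum π π-involutive f = begin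
    ∑ L (λ x → f (π x))                        ≡⟨ ∑-cong L (λ x → sym (enum .sift (π x) f)) ⟩
    ∑ L (λ x → ∑ L (λ y → 𝟙 (y ≟ π x) * f y))  ≡⟨ ∑-comm L L _ ⟩
    ∑ L (λ y → ∑ L (λ x → 𝟙 (y ≟ π x) * f y))  ≡⟨ ∑-cong L (λ y → ∑-cong L (λ x → cong (_* f y)
                                                    (𝟙-cong (swap y x) (y ≟ π x) (x ≟ π y)))) ⟩
    ∑ L (λ y → ∑ L (λ x → 𝟙 (x ≟ π y) * f y))  ≡⟨ ∑-cong L (λ y → enum .sift (π y) (λ _ → f y)) ⟩
    ∑ L f                                      ∎
    where
    swap : ∀ y x → (y ≡ π x) ⇔ (x ≡ π y)
    swap y x = mk⇔ (λ y≡πx → trans (sym (π-involutive x)) (cong π (sym y≡πx)))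
                   (λ x≡πy → trans (sym (π-involutive y)) (cong π (sym x≡πy)))

  δ-first : ∀ a b → (1# * a) + ((0# * b) + 0#) ≡ a
  δ-first a b = trans (cong₂ _+_ (*-identityˡ a) (trans (+-identityʳ _) (zeroˡ b))) (+-identityʳ a)

  δ-second : ∀ a b → (0# * a) + ((1# * b) + 0#) ≡ b
  δ-second a b = trans (cong₂ _+_ (zeroˡ a) (trans (+-identityʳ _) (*-identityˡ b))) (+-identityˡ b)

  bool-enumeration : IsEnumeration BoolP._≟_ (true ∷ false ∷ [])
  bool-enumeration .sift true  g = δ-first (g true) (g false)
  bool-enumeration .sift false g = δ-second (g true) (g false)

  allFin-enumeration : ∀ m → IsEnumeration FinP._≟_ (allFin m)
  allFin-enumeration (suc m) .sift zero g = begin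
    ∑ (allFin (suc m)) (λ x → 𝟙 (x FinP.≟ zero) * g x)
      ≡⟨ ∑-allFin-suc m _ ⟩
    (1# * g zero) + ∑ (allFin m) (λ x → 0# * g (suc x))
      ≡⟨ cong₂ _+_ (*-identityˡ _) (∑-cong (allFin m) (λ x → zeroˡ _)) ⟩
    g zero + ∑ (allFin m) (λ _ → 0#)
      ≡⟨ cong (g zero +_) (∑-zero (allFin m)) ⟩
    g zero + 0#
      ≡⟨ +-identityʳ _ ⟩
    g zero ∎
  allFin-enumeration (suc m) .sift (suc a) g = begin
    ∑ (allFin (suc m)) (λ x → 𝟙 (x FinP.≟ suc a) * g x)  ≡⟨ ∑-allFin-suc m _ ⟩
    (0# * g zero) + rest                                 ≡⟨ cong (_+ rest) (zeroˡ _) ⟩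
    0# + rest                                            ≡⟨ +-identityˡ _ ⟩
    rest                                                 ≡⟨ allFin-enumeration m .sift a (g ∘ suc) ⟩
    g (suc a)                                            ∎
    where
    rest : A
    rest = ∑ (allFin m) (λ x → 𝟙 (x FinP.≟ a) * g (suc x))

  cartesianProduct-enumeration : ∀ {_≟X_ : DecidableEquality X} {_≟Y_ : DecidableEquality Y} {xs ys} →
    IsEnumeration _≟X_ xs → IsEnumeration _≟Y_ ys →
    IsEnumeration (ProdP.≡-dec _≟X_ _≟Y_) (cartesianProduct xs ys)
  cartesianProduct-enumeration {_≟X_ = _≟X_} {_≟Y_} {xs} {ys} enumX enumY .sift (a , b) g = begin
    ∑ (cartesianProduct xs ys) (λ p → 𝟙 (p ≟ (a , b)) * g p)
      ≡⟨ ∑-cartesianProduct xs ys _ ⟩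
    ∑ xs (λ x → ∑ ys (λ y → 𝟙 ((x , y) ≟ (a , b)) * g (x , y)))
      ≡⟨ ∑-cong xs (λ x → ∑-cong ys (λ y → cong (_* g (x , y)) (split x y))) ⟩
    ∑ xs (λ x → ∑ ys (λ y → (𝟙 (x ≟X a) * 𝟙 (y ≟Y b)) * g (x , y)))
      ≡⟨ ∑-cong xs (λ x → trans (∑-cong ys (λ y → *-assoc _ _ _)) (sym (*-distribˡ-∑ _ ys _))) ⟩
    ∑ xs (λ x → 𝟙 (x ≟X a) * ∑ ys (λ y → 𝟙 (y ≟Y b) * g (x , y)))
      ≡⟨ ∑-cong xs (λ x → cong (𝟙 (x ≟X a) *_) (enumY .sift b (λ y → g (x , y)))) ⟩
    ∑ xs (λ x → 𝟙 (x ≟X a) * g (x , b))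
      ≡⟨ enumX .sift a (λ x → g (x , b)) ⟩
    g (a , b) ∎
    where
    _≟_ : DecidableEquality (_ × _)
    _≟_ = ProdP.≡-dec _≟X_ _≟Y_
    split : ∀ x y → 𝟙 ((x , y) ≟ (a , b)) ≡ 𝟙 (x ≟X a) * 𝟙 (y ≟Y b)
    split x y = 𝟙-× (mk⇔ ProdP.×-≡,≡←≡ ProdP.×-≡,≡→≡) ((x , y) ≟ (a , b)) (x ≟X a) (y ≟Y b)

  allVecs-enumeration : ∀ {_≟_ : DecidableEquality X} {L} → IsEnumeration _≟_ L →
    ∀ m → IsEnumeration (VecP.≡-dec _≟_) (allVecs L m)
  allVecs-enumeration enum zero .sift [] g = trans (cong (_+ 0#) (*-identityˡ _)) (+-identityʳ _)
  allVecs-enumeration {_≟_ = _≟_} {L} enum (suc m) .sift (a ∷ as) g = begin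
    ∑ (allVecs L (suc m)) (λ M → 𝟙 (M ≟ᵛ (a ∷ as)) * g M)
      ≡⟨ ∑-concatMap (λ x → map (x ∷_) (allVecs L m)) L _ ⟩
    ∑ L (λ x → ∑ (map (x ∷_) (allVecs L m)) (λ M → 𝟙 (M ≟ᵛ (a ∷ as)) * g M))
      ≡⟨ ∑-cong L (λ x → ∑-map (x ∷_) (allVecs L m) _) ⟩
    ∑ L (λ x → ∑ (allVecs L m) (λ M → 𝟙 ((x ∷ M) ≟ᵛ (a ∷ as)) * g (x ∷ M)))
      ≡⟨ ∑-cong L (λ x → ∑-cong (allVecs L m) (λ M → cong (_* g (x ∷ M)) (split x M))) ⟩
    ∑ L (λ x → ∑ (allVecs L m) (λ M → (𝟙 (x ≟ a) * 𝟙 (M ≟ᵛ as)) * g (x ∷ M)))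
      ≡⟨ ∑-cong L (λ x → trans (∑-cong (allVecs L m) (λ M → *-assoc _ _ _))
                               (sym (*-distribˡ-∑ _ (allVecs L m) _))) ⟩
    ∑ L (λ x → 𝟙 (x ≟ a) * ∑ (allVecs L m) (λ M → 𝟙 (M ≟ᵛ as) * g (x ∷ M)))
      ≡⟨ ∑-cong L (λ x → cong (𝟙 (x ≟ a) *_) (allVecs-enumeration enum m .sift as (λ M → g (x ∷ M)))) ⟩
    ∑ L (λ x → 𝟙 (x ≟ a) * g (x ∷ as))
      ≡⟨ enum .sift a (λ x → g (x ∷ as)) ⟩
    g (a ∷ as) ∎
    where
    _≟ᵛ_ : ∀ {k} → DecidableEquality (Vec _ k)
    _≟ᵛ_ = VecP.≡-dec _≟_
    split : ∀ x M → 𝟙 ((x ∷ M) ≟ᵛ (a ∷ as)) ≡ 𝟙 (x ≟ a) * 𝟙 (M ≟ᵛ as)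
    split x M = 𝟙-× (mk⇔ VecP.∷-injective (uncurry (cong₂ _∷_))) ((x ∷ M) ≟ᵛ (a ∷ as)) (x ≟ a) (M ≟ᵛ as)

module ℚΣ = FiniteSum (IsCommutativeRing.isCommutativeSemiring ℚP.+-*-isCommutativeRing)
module ℕΣ = FiniteSum ℕP.+-*-isCommutativeSemiring
open ℚΣ

sgn : ℕ → ℚ
sgn m = (- 1ℚ) ^ m

sgn-+ : ∀ m k → sgn (m ℕ.+ k) ≡ sgn m * sgn k
sgn-+ = ^-homo-* (- 1ℚ)

sgn-double : ∀ m → sgn (m ℕ.+ m) ≡ 1ℚ
sgn-double m = trans (sgn-+ m m) (square m)
  where
  square : ∀ m → sgn m * sgn m ≡ 1ℚ
  square zero    = refl
  square (suc m) = trans (negate² (sgn m)) (square m)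
    where
    negate² : ∀ s → (- 1ℚ * s) * (- 1ℚ * s) ≡ s * s
    negate² = solve 1 (λ s → (:- con 1ℚ :* s) :* (:- con 1ℚ :* s) := s :* s) refl

∏-sgn : ∀ {X : Set} (xs : List X) (f : X → ℕ) → ∏ xs (λ x → sgn (f x)) ≡ sgn (ℕΣ.∑ xs f)
∏-sgn []       f = refl
∏-sgn (x ∷ xs) f = trans (cong (sgn (f x) *_) (∏-sgn xs f)) (sym (sgn-+ (f x) (ℕΣ.∑ xs f)))

m+m≡n+n⇒m≡n : ∀ {m n} → m ℕ.+ m ≡ n ℕ.+ n → m ≡ n
m+m≡n+n⇒m≡n {m} {n} m+m≡n+n = ℕP.*-cancelˡ-≡ m n 2 (begin
  2 ℕ.* m  ≡⟨ cong (m ℕ.+_) (ℕP.+-identityʳ m) ⟩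
  m ℕ.+ m  ≡⟨ m+m≡n+n ⟩
  n ℕ.+ n  ≡⟨ cong (n ℕ.+_) (ℕP.+-identityʳ n) ⟨
  2 ℕ.* n  ∎)
  where open ≡-Reasoning

p≡-p⇒p≡0 : ∀ {p} → p ≡ - p → p ≡ 0ℚ
p≡-p⇒p≡0 {p} p≡-p = begin
  p              ≡⟨ halve p ⟩
  ½ * (p + p)    ≡⟨ cong (λ q → ½ * (p + q)) p≡-p ⟩
  ½ * (p + - p)  ≡⟨ cong (½ *_) (ℚP.+-inverseʳ p) ⟩
  ½ * 0ℚ         ≡⟨⟩
  0ℚ             ∎
  where
  open ≡-Reasoning
  halve : ∀ p → p ≡ ½ * (p + p)
  halve = solve 1 (λ p → p := con ½ :* (p :+ p)) refl

+-nonNeg : ∀ {p q} → 0ℚ ≤ p → 0ℚ ≤ q → 0ℚ ≤ p + q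
+-nonNeg = ℚP.+-mono-≤

*-nonNeg : ∀ {p q} → 0ℚ ≤ p → 0ℚ ≤ q → 0ℚ ≤ p * q
*-nonNeg {p} {q} 0≤p 0≤q =
  ℚP.nonNegative⁻¹ _ {{ℚP.nonNeg*nonNeg⇒nonNeg p {{nonNegative 0≤p}} q {{nonNegative 0≤q}}}}

∑-nonNeg : ∀ {X : Set} (xs : List X) {f : X → ℚ} → (∀ x → 0ℚ ≤ f x) → 0ℚ ≤ ∑ xs f
∑-nonNeg []       _   = ℚP.≤-refl
∑-nonNeg (x ∷ xs) 0≤f = +-nonNeg (0≤f x) (∑-nonNeg xs 0≤f)

∏-nonNeg : ∀ {X : Set} (xs : List X) {f : X → ℚ} → (∀ x → 0ℚ ≤ f x) → 0ℚ ≤ ∏ xs f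
∏-nonNeg []       _   = ℚP.nonNegative⁻¹ 1ℚ
∏-nonNeg (x ∷ xs) 0≤f = *-nonNeg (0≤f x) (∏-nonNeg xs 0≤f)

𝟙*-nonNeg : ∀ {P : Set} {x} (d : Dec P) → (P → 0ℚ ≤ x) → 0ℚ ≤ 𝟙 d * x
𝟙*-nonNeg         (yes p) 0≤x = subst (0ℚ ≤_) (sym (ℚP.*-identityˡ _)) (0≤x p)
𝟙*-nonNeg {x = x} (no _)  _   = ℚP.≤-reflexive (sym (ℚP.*-zeroˡ x))

p≤q⇒0≤q-p : ∀ {p q} → p ≤ q → 0ℚ ≤ q - p
p≤q⇒0≤q-p {p} {q} p≤q = subst (_≤ q - p) (ℚP.+-inverseʳ p) (ℚP.+-monoˡ-≤ (- p) p≤q)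

p≤p+q : ∀ {p q} → 0ℚ ≤ q → p ≤ p + q
p≤p+q {p} 0≤q = subst (_≤ p + _) (ℚP.+-identityʳ p) (ℚP.+-monoʳ-≤ p 0≤q)

-- Directed states are annotated circuit partitions

toParity : Bool → Parity
toParity false = 0ℙ
toParity true  = 1ℙ

toParity-not : ∀ b → toParity (not b) ≡ 1ℙ ℙ.+ toParity b
toParity-not false = refl
toParity-not true  = refl

parity≡0ℙ⇒2∣ : ∀ m → ℕ.parity m ≡ 0ℙ → 2 ∣ m
parity≡0ℙ⇒2∣ zero          _    = divides 0 refl
parity≡0ℙ⇒2∣ (suc (suc m)) even = ∣m∣n⇒∣m+n (∣-refl {2}) (parity≡0ℙ⇒2∣ m even)

module _ {n} {G : Graph4 n} {s : Assignment n} {o : Orientation n} (directed : IsDirected G s o) where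

  parity-step : ∀ v i → toParity (out o (step G s (v , i)))
                      ≡ ℕ.parity (minusBit (proj₂ (lookup s v))) ℙ.+ toParity (out o (v , i))
  parity-step v i with proj₂ (lookup s v) | proj₂ directed v i
  ... | plus  | passage = cong toParity (trans (proj₁ directed v _) (sym passage))
  ... | minus | passage = trans (cong toParity (trans (proj₁ directed v _) (cong not (sym passage))))
                                (toParity-not (out o (v , i)))

  parity-walk : ∀ m h → toParity (out o (iter (step G s) m h))
                      ≡ ℕ.parity (minusCount G s h m) ℙ.+ toParity (out o h)
  parity-walk zero    h       = refl
  parity-walk (suc m) (v , i) = begin
    toParity (out o (iter (step G s) m (step G s (v , i))))
      ≡⟨ parity-walk m (step G s (v , i)) ⟩
    ℕ.parity later ℙ.+ toParity (out o (step G s (v , i)))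
      ≡⟨ cong (ℕ.parity later ℙ.+_) (parity-step v i) ⟩
    ℕ.parity later ℙ.+ (ℕ.parity now ℙ.+ start)
      ≡⟨ ℙP.+-assoc (ℕ.parity later) (ℕ.parity now) start ⟨
    ℕ.parity later ℙ.+ ℕ.parity now ℙ.+ start
      ≡⟨ cong (ℙ._+ start) (ℙP.+-comm (ℕ.parity later) (ℕ.parity now)) ⟩
    ℕ.parity now ℙ.+ ℕ.parity later ℙ.+ start
      ≡⟨ cong (ℙ._+ start) (ℙP.+-homo-+ now later) ⟨
    ℕ.parity (now ℕ.+ later) ℙ.+ start ∎
    where
    open ≡-Reasoning
    now later : ℕ
    now   = minusBit (proj₂ (lookup s v))
    later = minusCount G s (step G s (v , i)) m
    start : Parity
    start = toParity (out o (v , i))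

  IsDirected⇒IsACP : IsACP G s
  IsDirected⇒IsACP v i k closes = parity≡0ℙ⇒2∣ _
    (ℙP.+-cancelʳ-≡ (toParity (out o (v , i))) _ 0ℙ
      (trans (sym (parity-walk (suc (toℕ k)) (v , i))) (cong (toParity ∘ out o) closes)))

-- The signature of a vertex in twisted characters

PassageOK? : ∀ sg x y → Dec (PassageOK sg x y)
PassageOK? plus  x y = x BoolP.≟ not y
PassageOK? minus x y = x BoolP.≟ y

Consistent : SignedPairing → Vec Bool 4 → Set
Consistent ϱ σ = ∀ i → PassageOK (proj₂ ϱ) (lookup σ i) (lookup σ (partner (proj₁ ϱ) i))

consistent? : ∀ ϱ σ → Dec (Consistent ϱ σ)
consistent? ϱ σ = FinP.all? λ i → PassageOK? (proj₂ ϱ) (lookup σ i) (lookup σ (partner (proj₁ ϱ) i))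

-- With the weights of the theorem, signature (w v) is the eight-vertex function with
-- parameters (a v , b v , c v , d v).
signature : (SignedPairing → ℚ) → Vec Bool 4 → ℚ
signature W σ = ∑ allSP (λ ϱ → 𝟙 (consistent? ϱ σ) * W ϱ)

-- The even sets of ends; block q false is the block of ⟨q⟩ containing e₁.
data Mode : Set where
  empty full : Mode
  block      : Fin 3 → Bool → Mode

modes : List Mode
modes = empty ∷ full ∷ cartesianProductWith block (allFin 3) (false ∷ true ∷ [])

_∈ᴹ_ : Fin 4 → Mode → Bool
i ∈ᴹ empty     = false
i ∈ᴹ full      = true
i ∈ᴹ block q b = b xor (does (i FinP.≟ zero) ∨ does (partner q i FinP.≟ zero))

pairCount : Mode → ℕ
pairCount empty       = 0
pairCount full        = 2
pairCount (block _ _) = 1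

bit : Bool → ℕ
bit b = if b then 1 else 0

outCount inCount : Mode → Vec Bool 4 → ℕ
outCount k σ = ℕΣ.∑ (allFin 4) (λ i → bit (i ∈ᴹ k ∧ lookup σ i))
inCount  k σ = ℕΣ.∑ (allFin 4) (λ i → bit (i ∈ᴹ k ∧ not (lookup σ i)))

-- The character of k twisted by (−1)^{|k|/2}: the twist makes both the coefficients γ and
-- the character sums over orientations nonnegative.
χ : Mode → Vec Bool 4 → ℚ
χ k σ = sgn (pairCount k ℕ.+ outCount k σ)

¼ : ℚ
¼ = ½ * ½

Δ : Fin 3 → SignedPairing → ℚ
Δ q ϱ = 𝟙 (ϱ ≟SP ⟨ q ⟩₊) - 𝟙 (ϱ ≟SP ⟨ q ⟩₋)

γ : Mode → SignedPairing → ℚ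
γ empty       _ = ¼
γ full        _ = ¼
γ (block q _) ϱ = ¼ * Δ q ϱ

∀-Bool? : {P : Bool → Set} → (∀ b → Dec (P b)) → Dec (∀ b → P b)
∀-Bool? P? = map′ (λ (t , f) → λ { true → t ; false → f }) (λ h → h true , h false)
                  (P? true ×-dec P? false)

∀-Sign? : {P : Sign → Set} → (∀ s → Dec (P s)) → Dec (∀ s → P s)
∀-Sign? P? = map′ (λ (p , m) → λ { plus → p ; minus → m }) (λ h → h plus , h minus)
                  (P? plus ×-dec P? minus)

∀-SignedPairing? : {P : SignedPairing → Set} → (∀ ϱ → Dec (P ϱ)) → Dec (∀ ϱ → P ϱ)
∀-SignedPairing? P? = map′ (λ h (q , s) → h q s) (λ h q s → h (q , s))
                           (FinP.all? λ q → ∀-Sign? λ s → P? (q , s))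

∀-Vec? : ∀ m {P : Vec Bool m → Set} → (∀ σ → Dec (P σ)) → Dec (∀ σ → P σ)
∀-Vec? zero    P? = map′ (λ p → λ { [] → p }) (λ h → h []) (P? [])
∀-Vec? (suc m) P? = map′ (λ h → λ { (b ∷ σ) → h b σ }) (λ h b σ → h (b ∷ σ))
                         (∀-Bool? λ b → ∀-Vec? m λ σ → P? (b ∷ σ))

∀-Mode? : {P : Mode → Set} → (∀ k → Dec (P k)) → Dec (∀ k → P k)
∀-Mode? P? = map′ (λ ((e , f) , b) → λ { empty → e ; full → f ; (block q s) → b q s })
                  (λ h → (h empty , h full) , λ q s → h (block q s))
                  ((P? empty ×-dec P? full) ×-dec FinP.all? λ q → ∀-Bool? λ s → P? (block q s))

indicator-expansion : ∀ ϱ σ → ∑ modes (λ k → γ k ϱ * χ k σ) ≡ 𝟙 (consistent? ϱ σ)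
indicator-expansion = from-yes (∀-SignedPairing? λ ϱ → ∀-Vec? 4 λ σ →
  ∑ modes (λ k → γ k ϱ * χ k σ) ℚP.≟ 𝟙 (consistent? ϱ σ))

outCount+inCount : ∀ k σ → outCount k σ ℕ.+ inCount k σ ≡ pairCount k ℕ.+ pairCount k
outCount+inCount = from-yes (∀-Mode? λ k → ∀-Vec? 4 λ σ →
  outCount k σ ℕ.+ inCount k σ ℕP.≟ pairCount k ℕ.+ pairCount k)

χ-flip : ∀ k i σ → χ k (σ [ i ]%= not) ≡ sgn (bit (i ∈ᴹ k)) * χ k σ
χ-flip = from-yes (∀-Mode? λ k → FinP.all? λ i → ∀-Vec? 4 λ σ →
  χ k (σ [ i ]%= not) ℚP.≟ sgn (bit (i ∈ᴹ k)) * χ k σ)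

Δ-antisymmetric : ∀ p q → Δ p ⟨ q ⟩₋ ≡ - Δ p ⟨ q ⟩₊
Δ-antisymmetric = from-yes (FinP.all? λ p → FinP.all? λ q → Δ p ⟨ q ⟩₋ ℚP.≟ - Δ p ⟨ q ⟩₊)

Δ-nonNeg : ∀ p q → 0ℚ ≤ Δ p ⟨ q ⟩₊
Δ-nonNeg = from-yes (FinP.all? λ p → FinP.all? λ q → 0ℚ ℚP.≤? Δ p ⟨ q ⟩₊)

sign-enumeration : IsEnumeration _≟Sign_ (plus ∷ minus ∷ [])
sign-enumeration .sift plus  g = δ-first (g plus) (g minus)
sign-enumeration .sift minus g = δ-second (g plus) (g minus)

signedPairing-enumeration : IsEnumeration _≟SP_ allSP
signedPairing-enumeration = cartesianProduct-enumeration (allFin-enumeration 3) sign-enumeration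

coefficient : (SignedPairing → ℚ) → Mode → ℚ
coefficient W k = ∑ allSP (λ ϱ → γ k ϱ * W ϱ)

signature-expansion : ∀ W σ → signature W σ ≡ ∑ modes (λ k → coefficient W k * χ k σ)
signature-expansion W σ = begin
  ∑ allSP (λ ϱ → 𝟙 (consistent? ϱ σ) * W ϱ)
    ≡⟨ ∑-cong allSP (λ ϱ → cong (_* W ϱ) (sym (indicator-expansion ϱ σ))) ⟩
  ∑ allSP (λ ϱ → ∑ modes (λ k → γ k ϱ * χ k σ) * W ϱ)
    ≡⟨ ∑-cong allSP (λ ϱ → *-distribʳ-∑ (W ϱ) modes (λ k → γ k ϱ * χ k σ)) ⟩
  ∑ allSP (λ ϱ → ∑ modes (λ k → γ k ϱ * χ k σ * W ϱ))
    ≡⟨ ∑-comm allSP modes (λ ϱ k → γ k ϱ * χ k σ * W ϱ) ⟩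
  ∑ modes (λ k → ∑ allSP (λ ϱ → γ k ϱ * χ k σ * W ϱ))
    ≡⟨ ∑-cong modes (λ k → trans (∑-cong allSP (λ ϱ → swap (γ k ϱ) (χ k σ) (W ϱ)))
                                 (sym (*-distribʳ-∑ (χ k σ) allSP (λ ϱ → γ k ϱ * W ϱ)))) ⟩
  ∑ modes (λ k → coefficient W k * χ k σ) ∎
  where
  open ≡-Reasoning
  swap : ∀ a b c → a * b * c ≡ a * c * b
  swap = solve 3 (λ a b c → a :* b :* c := a :* c :* b) refl

∑-Δ : ∀ q (W : SignedPairing → ℚ) → ∑ allSP (λ ϱ → Δ q ϱ * W ϱ) ≡ W ⟨ q ⟩₊ - W ⟨ q ⟩₋
∑-Δ q W = begin
  ∑ allSP (λ ϱ → Δ q ϱ * W ϱ)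
    ≡⟨ ∑-cong allSP (λ ϱ → split (δ₊ ϱ) (δ₋ ϱ) (W ϱ)) ⟩
  ∑ allSP (λ ϱ → δ₊ ϱ * W ϱ + - 1ℚ * (δ₋ ϱ * W ϱ))
    ≡⟨ ∑-distrib-+ allSP (λ ϱ → δ₊ ϱ * W ϱ) (λ ϱ → - 1ℚ * (δ₋ ϱ * W ϱ)) ⟩
  ∑ allSP (λ ϱ → δ₊ ϱ * W ϱ) + ∑ allSP (λ ϱ → - 1ℚ * (δ₋ ϱ * W ϱ))
    ≡⟨ cong (∑ allSP (λ ϱ → δ₊ ϱ * W ϱ) +_) (*-distribˡ-∑ (- 1ℚ) allSP (λ ϱ → δ₋ ϱ * W ϱ)) ⟨
  ∑ allSP (λ ϱ → δ₊ ϱ * W ϱ) + - 1ℚ * ∑ allSP (λ ϱ → δ₋ ϱ * W ϱ)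
    ≡⟨ cong₂ (λ a b → a + - 1ℚ * b) (signedPairing-enumeration .sift ⟨ q ⟩₊ W)
                                     (signedPairing-enumeration .sift ⟨ q ⟩₋ W) ⟩
  W ⟨ q ⟩₊ + - 1ℚ * W ⟨ q ⟩₋
    ≡⟨ as-difference (W ⟨ q ⟩₊) (W ⟨ q ⟩₋) ⟩
  W ⟨ q ⟩₊ - W ⟨ q ⟩₋ ∎
  where
  open ≡-Reasoning
  δ₊ δ₋ : SignedPairing → ℚ
  δ₊ ϱ = 𝟙 (ϱ ≟SP ⟨ q ⟩₊)
  δ₋ ϱ = 𝟙 (ϱ ≟SP ⟨ q ⟩₋)
  split : ∀ a b w → (a - b) * w ≡ a * w + - 1ℚ * (b * w)
  split = solve 3 (λ a b w → (a :- b) :* w := a :* w :+ (:- con 1ℚ) :* (b :* w)) refl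
  as-difference : ∀ a b → a + - 1ℚ * b ≡ a - b
  as-difference = solve 2 (λ a b → a :+ (:- con 1ℚ) :* b := a :- b) refl

coefficient-block : ∀ W q b → coefficient W (block q b) ≡ ¼ * (W ⟨ q ⟩₊ - W ⟨ q ⟩₋)
coefficient-block W q b = begin
  ∑ allSP (λ ϱ → ¼ * Δ q ϱ * W ϱ)    ≡⟨ ∑-cong allSP (λ ϱ → ℚP.*-assoc ¼ (Δ q ϱ) (W ϱ)) ⟩
  ∑ allSP (λ ϱ → ¼ * (Δ q ϱ * W ϱ))  ≡⟨ *-distribˡ-∑ ¼ allSP (λ ϱ → Δ q ϱ * W ϱ) ⟨
  ¼ * ∑ allSP (λ ϱ → Δ q ϱ * W ϱ)    ≡⟨ cong (¼ *_) (∑-Δ q W) ⟩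
  ¼ * (W ⟨ q ⟩₊ - W ⟨ q ⟩₋)          ∎
  where open ≡-Reasoning

0≤¼ : 0ℚ ≤ ¼
0≤¼ = ℚP.nonNegative⁻¹ ¼

Dominant : (SignedPairing → ℚ) → Set
Dominant W = ∀ q → W ⟨ q ⟩₋ ≤ W ⟨ q ⟩₊

coefficient-nonNeg : ∀ W → Dominant W → 0ℚ ≤ ∑ allSP W → ∀ k → 0ℚ ≤ coefficient W k
coefficient-nonNeg W _   0≤∑W empty       = subst (0ℚ ≤_) (*-distribˡ-∑ ¼ allSP W) (*-nonNeg 0≤¼ 0≤∑W)
coefficient-nonNeg W _   0≤∑W full        = subst (0ℚ ≤_) (*-distribˡ-∑ ¼ allSP W) (*-nonNeg 0≤¼ 0≤∑W)
coefficient-nonNeg W dom _    (block q b) =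
  subst (0ℚ ≤_) (sym (coefficient-block W q b)) (*-nonNeg 0≤¼ (p≤q⇒0≤q-p (dom q)))

Δ-dominant : ∀ p {W : SignedPairing → ℚ} → (∀ ϱ → 0ℚ ≤ W ϱ) → Dominant (λ ϱ → Δ p ϱ * W ϱ)
Δ-dominant p {W} 0≤W q = begin
  Δ p ⟨ q ⟩₋ * W ⟨ q ⟩₋       ≡⟨ cong (_* W ⟨ q ⟩₋) (Δ-antisymmetric p q) ⟩
  - Δ p ⟨ q ⟩₊ * W ⟨ q ⟩₋     ≡⟨ ℚP.neg-distribˡ-* (Δ p ⟨ q ⟩₊) (W ⟨ q ⟩₋) ⟨
  - (Δ p ⟨ q ⟩₊ * W ⟨ q ⟩₋)   ≤⟨ ℚP.neg-antimono-≤ (*-nonNeg (Δ-nonNeg p q) (0≤W ⟨ q ⟩₋)) ⟩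
  0ℚ                          ≤⟨ *-nonNeg (Δ-nonNeg p q) (0≤W ⟨ q ⟩₊) ⟩
  Δ p ⟨ q ⟩₊ * W ⟨ q ⟩₊       ∎
  where open ℚP.≤-Reasoning

_≟HE_ : ∀ {n} → DecidableEquality (HalfEdge n)
_≟HE_ = ProdP.≡-dec FinP._≟_ FinP._≟_

halfEdges : ∀ {n} → List (HalfEdge n)
halfEdges {n} = cartesianProduct (allFin n) (allFin 4)

orientations : ∀ {n} → List (Orientation n)
orientations {n} = allVecs (allVecs (true ∷ false ∷ []) 4) n

assignments : ∀ {n} → List (Assignment n)
assignments {n} = allVecs allSP n

halfEdge-enumeration : ∀ {n} → ℕΣ.IsEnumeration _≟HE_ (halfEdges {n})
halfEdge-enumeration {n} = ℕΣ.cartesianProduct-enumeration (ℕΣ.allFin-enumeration n) (ℕΣ.allFin-enumeration 4)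

orientation-enumeration : ∀ {n} → IsEnumeration (VecP.≡-dec (VecP.≡-dec BoolP._≟_)) (orientations {n})
orientation-enumeration {n} = allVecs-enumeration (allVecs-enumeration bool-enumeration 4) n

flipAt : ∀ {n} → HalfEdge n → Orientation n → Orientation n
flipAt (u , i) o = o [ u ]%= (_[ i ]%= not)

flipAt-involutive : ∀ {n} (g : HalfEdge n) o → flipAt g (flipAt g o) ≡ o
flipAt-involutive (u , i) o =
  trans (VecP.updateAt-updateAt u o) (VecP.updateAt-id-local u o (flip-flip (lookup o u)))
  where
  flip-flip : ∀ σ → (σ [ i ]%= not) [ i ]%= not ≡ σ
  flip-flip σ = trans (VecP.updateAt-updateAt i σ) (VecP.updateAt-id-local i σ (BoolP.not-involutive _))

flipAt-comm : ∀ {n} (g h : HalfEdge n) o → flipAt g (flipAt h o) ≡ flipAt h (flipAt g o)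
flipAt-comm (u , i) (u′ , i′) o with u FinP.≟ u′
... | no u≢u′  = VecP.updateAt-commutes u u′ u≢u′ o
... | yes refl = begin
  (o [ u ]%= (_[ i′ ]%= not)) [ u ]%= (_[ i ]%= not)  ≡⟨ VecP.updateAt-updateAt u o ⟩
  o [ u ]%= (λ σ → (σ [ i′ ]%= not) [ i ]%= not)      ≡⟨ VecP.updateAt-cong u bits-commute o ⟩
  o [ u ]%= (λ σ → (σ [ i ]%= not) [ i′ ]%= not)      ≡⟨ VecP.updateAt-updateAt u o ⟨
  (o [ u ]%= (_[ i ]%= not)) [ u ]%= (_[ i′ ]%= not)  ∎
  where
  open ≡-Reasoning
  bits-commute : ∀ σ → (σ [ i′ ]%= not) [ i ]%= not ≡ (σ [ i ]%= not) [ i′ ]%= not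
  bits-commute σ with i FinP.≟ i′
  ... | yes refl = refl
  ... | no i≢i′  = VecP.updateAt-commutes i i′ i≢i′ σ

-- Matching on u′ ≟ u also evaluates the decision (u′ , i′) ≟HE (u , i) in the goal.
out-flipAt : ∀ {n} (g : HalfEdge n) o x → out (flipAt g o) x ≡ does (x ≟HE g) xor out o x
out-flipAt (u , i) o (u′ , i′) with u′ FinP.≟ u
... | no u′≢u  = cong (λ σ → lookup σ i′) (VecP.lookup∘updateAt′ u′ u u′≢u o)
... | yes refl = trans (cong (λ σ → lookup σ i′) (VecP.lookup∘updateAt u o)) flipped-bit
  where
  flipped-bit : lookup (lookup o u [ i ]%= not) i′ ≡ does (i′ FinP.≟ i) xor out o (u , i′)
  flipped-bit with i′ FinP.≟ i
  ... | yes refl = VecP.lookup∘updateAt i (lookup o u)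
  ... | no i′≢i  = VecP.lookup∘updateAt′ i′ i i′≢i (lookup o u)

xor-not-exchange : ∀ a b c → a xor (b xor not c) ≡ not (b xor (a xor c))
xor-not-exchange true  true  c = refl
xor-not-exchange true  false c = refl
xor-not-exchange false true  c = refl
xor-not-exchange false false c = refl

selects : ∀ {n} → Vec Mode n → HalfEdge n → Bool
selects κ (u , i) = i ∈ᴹ lookup κ u

χᴳ : ∀ {n} → Vec Mode n → Orientation n → ℚ
χᴳ {n} κ o = ∏ (allFin n) (λ u → χ (lookup κ u) (lookup o u))

χᴳ-flipAt : ∀ {n} κ (g : HalfEdge n) o → χᴳ κ (flipAt g o) ≡ sgn (bit (selects κ g)) * χᴳ κ o
χᴳ-flipAt {n} κ (u , i) o = ∏-allFin-scale n (χ-at o) (χ-at (flipAt (u , i) o)) u (sgn (bit (i ∈ᴹ lookup κ u)))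
  (trans (cong (χ (lookup κ u)) (VecP.lookup∘updateAt u o)) (χ-flip (lookup κ u) i (lookup o u)))
  (λ u′ u′≢u → cong (χ (lookup κ u′)) (VecP.lookup∘updateAt′ u′ u u′≢u o))
  where
  χ-at : Orientation n → Fin n → ℚ
  χ-at o u′ = χ (lookup κ u′) (lookup o u′)

opposite-signs : ∀ {a b} → a ≢ b → ∀ x → sgn (bit a) * (sgn (bit b) * x) ≡ - x
opposite-signs {true}  {true}  a≢b = ⊥-elim (a≢b refl)
opposite-signs {true}  {false} _   = solve 1 (λ x → (:- con 1ℚ :* con 1ℚ) :* (con 1ℚ :* x) := :- x) refl
opposite-signs {false} {true}  _   = solve 1 (λ x → con 1ℚ :* ((:- con 1ℚ :* con 1ℚ) :* x) := :- x) refl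
opposite-signs {false} {false} a≢b = ⊥-elim (a≢b refl)

-- Character sums over orientations

module _ {n : ℕ} (G : Graph4 n) where

  IsOrientation? : ∀ o → Dec (IsOrientation G o)
  IsOrientation? o = FinP.all? λ v → FinP.all? λ i → out o (other G (v , i)) BoolP.≟ not (out o (v , i))

  characterSum : Vec Mode n → ℚ
  characterSum κ = ∑ orientations (λ o → 𝟙 (IsOrientation? o) * χᴳ κ o)

  Closed : Vec Mode n → Set
  Closed κ = ∀ u i → selects κ (other G (u , i)) ≡ selects κ (u , i)

  ∑-outCount≡∑-inCount : ∀ {κ o} → Closed κ → IsOrientation G o →
    ℕΣ.∑ (allFin n) (λ u → outCount (lookup κ u) (lookup o u))
      ≡ ℕΣ.∑ (allFin n) (λ u → inCount (lookup κ u) (lookup o u))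
  ∑-outCount≡∑-inCount {κ} {o} closed valid = begin
    ℕΣ.∑ (allFin n) (λ u → ℕΣ.∑ (allFin 4) (λ i → selectedOut (u , i)))
      ≡⟨ ℕΣ.∑-cartesianProduct (allFin n) (allFin 4) selectedOut ⟨
    ℕΣ.∑ halfEdges selectedOut
      ≡⟨ ℕΣ.∑-involution halfEdge-enumeration (other G) (other-invol G) selectedOut ⟨
    ℕΣ.∑ halfEdges (selectedOut ∘ other G)
      ≡⟨ ℕΣ.∑-cong halfEdges (λ (u , i) → cong₂ (λ a b → bit (a ∧ b)) (closed u i) (valid u i)) ⟩
    ℕΣ.∑ halfEdges selectedIn
      ≡⟨ ℕΣ.∑-cartesianProduct (allFin n) (allFin 4) selectedIn ⟩
    ℕΣ.∑ (allFin n) (λ u → ℕΣ.∑ (allFin 4) (λ i → selectedIn (u , i))) ∎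
    where
    open ≡-Reasoning
    selectedOut selectedIn : HalfEdge n → ℕ
    selectedOut h = bit (selects κ h ∧ out o h)
    selectedIn  h = bit (selects κ h ∧ not (out o h))

  χᴳ-closed : ∀ {κ o} → Closed κ → IsOrientation G o → χᴳ κ o ≡ 1ℚ
  χᴳ-closed {κ} {o} closed valid = begin
    χᴳ κ o                 ≡⟨ ∏-sgn (allFin n) exponent ⟩
    sgn (ℕΣ.∑ (allFin n) exponent)
                           ≡⟨ cong sgn (ℕΣ.∑-distrib-+ (allFin n) _ _) ⟩
    sgn (pairs ℕ.+ outs)   ≡⟨ cong (λ t → sgn (pairs ℕ.+ t)) outs≡pairs ⟩
    sgn (pairs ℕ.+ pairs)  ≡⟨ sgn-double pairs ⟩
    1ℚ                     ∎
    where
    open ≡-Reasoning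
    exponent : Fin n → ℕ
    exponent u = pairCount (lookup κ u) ℕ.+ outCount (lookup κ u) (lookup o u)
    pairs outs ins : ℕ
    pairs = ℕΣ.∑ (allFin n) (λ u → pairCount (lookup κ u))
    outs  = ℕΣ.∑ (allFin n) (λ u → outCount (lookup κ u) (lookup o u))
    ins   = ℕΣ.∑ (allFin n) (λ u → inCount (lookup κ u) (lookup o u))
    outs+ins≡pairs+pairs : outs ℕ.+ ins ≡ pairs ℕ.+ pairs
    outs+ins≡pairs+pairs = begin
      outs ℕ.+ ins
        ≡⟨ ℕΣ.∑-distrib-+ (allFin n) _ _ ⟨
      ℕΣ.∑ (allFin n) (λ u → outCount (lookup κ u) (lookup o u) ℕ.+ inCount (lookup κ u) (lookup o u))
        ≡⟨ ℕΣ.∑-cong (allFin n) (λ u → outCount+inCount (lookup κ u) (lookup o u)) ⟩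
      ℕΣ.∑ (allFin n) (λ u → pairCount (lookup κ u) ℕ.+ pairCount (lookup κ u))
        ≡⟨ ℕΣ.∑-distrib-+ (allFin n) _ _ ⟩
      pairs ℕ.+ pairs ∎
    outs≡pairs : outs ≡ pairs
    outs≡pairs = m+m≡n+n⇒m≡n
      (trans (cong (outs ℕ.+_) (∑-outCount≡∑-inCount {κ} {o} closed valid)) outs+ins≡pairs+pairs)

  flipEdge : HalfEdge n → Orientation n → Orientation n
  flipEdge h o = flipAt (other G h) (flipAt h o)

  flipEdge-involutive : ∀ h o → flipEdge h (flipEdge h o) ≡ o
  flipEdge-involutive h o = begin
    flipAt h′ (flipAt h (flipAt h′ (flipAt h o)))  ≡⟨ cong (flipAt h′) (flipAt-comm h h′ (flipAt h o)) ⟩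
    flipAt h′ (flipAt h′ (flipAt h (flipAt h o)))  ≡⟨ flipAt-involutive h′ (flipAt h (flipAt h o)) ⟩
    flipAt h (flipAt h o)                          ≡⟨ flipAt-involutive h o ⟩
    o                                              ∎
    where
    open ≡-Reasoning
    h′ : HalfEdge n
    h′ = other G h

  flipEdge-preserves : ∀ h o → IsOrientation G o → IsOrientation G (flipEdge h o)
  flipEdge-preserves h o valid u i = begin
    out (flipEdge h o) (other G x)
      ≡⟨ out-flipEdge (other G x) ⟩
    does (other G x ≟HE h′) xor (does (other G x ≟HE h) xor out o (other G x))
      ≡⟨ cong₂ (λ a b → a xor (b xor out o (other G x)))
               (does-⇔ (mk⇔ other-injective (cong (other G))) (other G x ≟HE h′) (x ≟HE h))
               (does-⇔ (mk⇔ other-swap other-unswap) (other G x ≟HE h) (x ≟HE h′)) ⟩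
    does (x ≟HE h) xor (does (x ≟HE h′) xor out o (other G x))
      ≡⟨ cong (λ b → does (x ≟HE h) xor (does (x ≟HE h′) xor b)) (valid u i) ⟩
    does (x ≟HE h) xor (does (x ≟HE h′) xor not (out o x))
      ≡⟨ xor-not-exchange (does (x ≟HE h)) (does (x ≟HE h′)) (out o x) ⟩
    not (does (x ≟HE h′) xor (does (x ≟HE h) xor out o x))
      ≡⟨ cong not (out-flipEdge x) ⟨
    not (out (flipEdge h o) x) ∎
    where
    open ≡-Reasoning
    x h′ : HalfEdge n
    x  = (u , i)
    h′ = other G h
    out-flipEdge : ∀ y → out (flipEdge h o) y ≡ does (y ≟HE h′) xor (does (y ≟HE h) xor out o y)
    out-flipEdge y = trans (out-flipAt h′ (flipAt h o) y) (cong (does (y ≟HE h′) xor_) (out-flipAt h o y))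
    other-injective : other G x ≡ other G h → x ≡ h
    other-injective e = trans (sym (other-invol G x)) (trans (cong (other G) e) (other-invol G h))
    other-swap : other G x ≡ h → x ≡ h′
    other-swap e = trans (sym (other-invol G x)) (cong (other G) e)
    other-unswap : x ≡ h′ → other G x ≡ h
    other-unswap e = trans (cong (other G) e) (other-invol G h)

  χᴳ-flipEdge : ∀ κ h o → selects κ (other G h) ≢ selects κ h → χᴳ κ (flipEdge h o) ≡ - χᴳ κ o
  χᴳ-flipEdge κ h o differ = begin
    χᴳ κ (flipAt h′ (flipAt h o))
      ≡⟨ χᴳ-flipAt κ h′ (flipAt h o) ⟩
    sgn (bit (selects κ h′)) * χᴳ κ (flipAt h o)
      ≡⟨ cong (sgn (bit (selects κ h′)) *_) (χᴳ-flipAt κ h o) ⟩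
    sgn (bit (selects κ h′)) * (sgn (bit (selects κ h)) * χᴳ κ o)
      ≡⟨ opposite-signs differ (χᴳ κ o) ⟩
    - χᴳ κ o ∎
    where
    open ≡-Reasoning
    h′ : HalfEdge n
    h′ = other G h

  characterSum-open : ∀ κ h → selects κ (other G h) ≢ selects κ h → characterSum κ ≡ 0ℚ
  characterSum-open κ h differ = p≡-p⇒p≡0 (begin
    ∑ orientations term
      ≡⟨ ∑-involution orientation-enumeration (flipEdge h) (flipEdge-involutive h) term ⟨
    ∑ orientations (term ∘ flipEdge h)
      ≡⟨ ∑-cong orientations flipped ⟩
    ∑ orientations (λ o → - 1ℚ * term o)
      ≡⟨ *-distribˡ-∑ (- 1ℚ) orientations term ⟨
    - 1ℚ * ∑ orientations term
      ≡⟨ negate (∑ orientations term) ⟩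
    - ∑ orientations term ∎)
    where
    open ≡-Reasoning
    term : Orientation n → ℚ
    term o = 𝟙 (IsOrientation? o) * χᴳ κ o
    negate : ∀ a → - 1ℚ * a ≡ - a
    negate = solve 1 (λ a → (:- con 1ℚ) :* a := :- a) refl
    valid⇔ : ∀ o → IsOrientation G (flipEdge h o) ⇔ IsOrientation G o
    valid⇔ o = mk⇔ (subst (IsOrientation G) (flipEdge-involutive h o) ∘ flipEdge-preserves h (flipEdge h o))
                   (flipEdge-preserves h o)
    flipped : ∀ o → term (flipEdge h o) ≡ - 1ℚ * term o
    flipped o = begin
      𝟙 (IsOrientation? (flipEdge h o)) * χᴳ κ (flipEdge h o)
        ≡⟨ cong₂ _*_ (𝟙-cong (valid⇔ o) (IsOrientation? (flipEdge h o)) (IsOrientation? o))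
                     (χᴳ-flipEdge κ h o differ) ⟩
      𝟙 (IsOrientation? o) * - χᴳ κ o
        ≡⟨ pull-sign (𝟙 (IsOrientation? o)) (χᴳ κ o) ⟩
      - 1ℚ * term o ∎
      where
      pull-sign : ∀ a b → a * - b ≡ - 1ℚ * (a * b)
      pull-sign = solve 2 (λ a b → a :* (:- b) := (:- con 1ℚ) :* (a :* b)) refl

  closed-at? : ∀ κ u i → Dec (selects κ (other G (u , i)) ≡ selects κ (u , i))
  closed-at? κ u i = selects κ (other G (u , i)) BoolP.≟ selects κ (u , i)

  open-halfEdge : ∀ κ → ¬ Closed κ → ∃ λ h → selects κ (other G h) ≢ selects κ h
  open-halfEdge κ ¬closed =
    let u , ¬closed-at-u = FinP.¬∀⟶∃¬ n _ (λ u → FinP.all? (closed-at? κ u)) ¬closed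
        i , differ       = FinP.¬∀⟶∃¬ 4 _ (closed-at? κ u) ¬closed-at-u
    in (u , i) , differ

  characterSum-nonNeg : ∀ κ → 0ℚ ≤ characterSum κ
  characterSum-nonNeg κ with FinP.all? (λ u → FinP.all? (closed-at? κ u))
  ... | yes closed = ∑-nonNeg orientations λ o → 𝟙*-nonNeg (IsOrientation? o) λ valid →
                       subst (0ℚ ≤_) (sym (χᴳ-closed {κ} {o} closed valid)) (ℚP.nonNegative⁻¹ 1ℚ)
  ... | no ¬closed = let h , differ = open-halfEdge κ ¬closed in
                     ℚP.≤-reflexive (sym (characterSum-open κ h differ))

-- Positivity of the partition function

coefficientProduct : ∀ {n} → (Fin n → SignedPairing → ℚ) → Vec Mode n → ℚ
coefficientProduct {n} W κ = ∏ (allFin n) (λ u → coefficient (W u) (lookup κ u))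

∏-signature-expansion : ∀ {n} (W : Fin n → SignedPairing → ℚ) (o : Orientation n) →
  ∏ (allFin n) (λ u → signature (W u) (lookup o u))
    ≡ ∑ (allVecs modes n) (λ κ → coefficientProduct W κ * χᴳ κ o)
∏-signature-expansion {n} W o = begin
  ∏ (allFin n) (λ u → signature (W u) (lookup o u))
    ≡⟨ ∏-cong (allFin n) (λ u → signature-expansion (W u) (lookup o u)) ⟩
  ∏ (allFin n) (λ u → ∑ modes (λ k → coefficient (W u) k * χ k (lookup o u)))
    ≡⟨ ∏-∑-allVecs modes n (λ u k → coefficient (W u) k * χ k (lookup o u)) ⟩
  ∑ (allVecs modes n) (λ κ → ∏ (allFin n) (λ u → coefficient (W u) (lookup κ u) * χ (lookup κ u) (lookup o u)))
    ≡⟨ ∑-cong (allVecs modes n) (λ κ → ∏-distrib-* (allFin n) _ _) ⟩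
  ∑ (allVecs modes n) (λ κ → coefficientProduct W κ * χᴳ κ o) ∎
  where open ≡-Reasoning

module _ {n : ℕ} (G : Graph4 n) where

  partitionFunction : (Fin n → SignedPairing → ℚ) → ℚ
  partitionFunction W = ∑ assignments λ s → ∑ orientations λ o →
    𝟙 (IsDirected? G s o) * ∏ (allFin n) (λ u → W u (lookup s u))

  𝟙-IsDirected : ∀ s o → 𝟙 (IsDirected? G s o)
    ≡ 𝟙 (IsOrientation? G o) * ∏ (allFin n) (λ u → 𝟙 (consistent? (lookup s u) (lookup o u)))
  𝟙-IsDirected s o = trans (𝟙-× (mk⇔ id id) (IsDirected? G s o) (IsOrientation? G o) passages)
    (cong (𝟙 (IsOrientation? G o) *_) (𝟙-∀ n (λ u → consistent? (lookup s u) (lookup o u)) passages))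
    where
    passages : Dec (∀ u → Consistent (lookup s u) (lookup o u))
    passages = FinP.all? λ u → consistent? (lookup s u) (lookup o u)

  ∑-assignments≡signatures : ∀ (W : Fin n → SignedPairing → ℚ) o →
    ∑ assignments (λ s → 𝟙 (IsDirected? G s o) * ∏ (allFin n) (λ u → W u (lookup s u)))
      ≡ 𝟙 (IsOrientation? G o) * ∏ (allFin n) (λ u → signature (W u) (lookup o u))
  ∑-assignments≡signatures W o = begin
    ∑ assignments (λ s → 𝟙 (IsDirected? G s o) * weightOf s)
      ≡⟨ ∑-cong assignments (λ s → cong (_* weightOf s) (𝟙-IsDirected s o)) ⟩
    ∑ assignments (λ s → 𝟙 valid? * consistentAt s * weightOf s)
      ≡⟨ ∑-cong assignments (λ s → trans (ℚP.*-assoc (𝟙 valid?) (consistentAt s) (weightOf s))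
           (cong (𝟙 valid? *_) (sym (∏-distrib-* (allFin n) (λ u → 𝟙 (consistent? (lookup s u) (lookup o u)))
                                                           (λ u → W u (lookup s u)))))) ⟩
    ∑ assignments (λ s → 𝟙 valid? * ∏ (allFin n) (λ u → local u (lookup s u)))
      ≡⟨ *-distribˡ-∑ (𝟙 valid?) assignments (λ s → ∏ (allFin n) (λ u → local u (lookup s u))) ⟨
    𝟙 valid? * ∑ assignments (λ s → ∏ (allFin n) (λ u → local u (lookup s u)))
      ≡⟨ cong (𝟙 valid? *_) (∏-∑-allVecs allSP n local) ⟨
    𝟙 valid? * ∏ (allFin n) (λ u → signature (W u) (lookup o u)) ∎
    where
    open ≡-Reasoning
    valid? : Dec (IsOrientation G o)
    valid? = IsOrientation? G o
    weightOf consistentAt : Assignment n → ℚ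
    weightOf s     = ∏ (allFin n) (λ u → W u (lookup s u))
    consistentAt s = ∏ (allFin n) (λ u → 𝟙 (consistent? (lookup s u) (lookup o u)))
    local : Fin n → SignedPairing → ℚ
    local u ϱ = 𝟙 (consistent? ϱ (lookup o u)) * W u ϱ

  partitionFunction-expansion : ∀ (W : Fin n → SignedPairing → ℚ) →
    partitionFunction W ≡ ∑ (allVecs modes n) (λ κ → coefficientProduct W κ * characterSum G κ)
  partitionFunction-expansion W = begin
    ∑ assignments (λ s → ∑ orientations (λ o → term s o))
      ≡⟨ ∑-comm assignments orientations term ⟩
    ∑ orientations (λ o → ∑ assignments (λ s → term s o))
      ≡⟨ ∑-cong orientations (λ o → trans (∑-assignments≡signatures W o)
                                          (cong (𝟙 (IsOrientation? G o) *_) (∏-signature-expansion W o))) ⟩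
    ∑ orientations (λ o → 𝟙 (IsOrientation? G o) * ∑ κs (λ κ → C κ * χᴳ κ o))
      ≡⟨ ∑-cong orientations (λ o → *-distribˡ-∑ (𝟙 (IsOrientation? G o)) κs (λ κ → C κ * χᴳ κ o)) ⟩
    ∑ orientations (λ o → ∑ κs (λ κ → 𝟙 (IsOrientation? G o) * (C κ * χᴳ κ o)))
      ≡⟨ ∑-comm orientations κs (λ o κ → 𝟙 (IsOrientation? G o) * (C κ * χᴳ κ o)) ⟩
    ∑ κs (λ κ → ∑ orientations (λ o → 𝟙 (IsOrientation? G o) * (C κ * χᴳ κ o)))
      ≡⟨ ∑-cong κs (λ κ → trans (∑-cong orientations (λ o → exchange (𝟙 (IsOrientation? G o)) (C κ) (χᴳ κ o)))
                                (sym (*-distribˡ-∑ (C κ) orientations (λ o → 𝟙 (IsOrientation? G o) * χᴳ κ o)))) ⟩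
    ∑ κs (λ κ → C κ * characterSum G κ) ∎
    where
    open ≡-Reasoning
    κs : List (Vec Mode n)
    κs = allVecs modes n
    C : Vec Mode n → ℚ
    C = coefficientProduct W
    term : Assignment n → Orientation n → ℚ
    term s o = 𝟙 (IsDirected? G s o) * ∏ (allFin n) (λ u → W u (lookup s u))
    exchange : ∀ a b c → a * (b * c) ≡ b * (a * c)
    exchange = solve 3 (λ a b c → a :* (b :* c) := b :* (a :* c)) refl

  partitionFunction-nonNeg : ∀ (W : Fin n → SignedPairing → ℚ) →
    (∀ u k → 0ℚ ≤ coefficient (W u) k) → 0ℚ ≤ partitionFunction W
  partitionFunction-nonNeg W 0≤coefficient = subst (0ℚ ≤_) (sym (partitionFunction-expansion W))
    (∑-nonNeg (allVecs modes n) λ κ →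
      *-nonNeg (∏-nonNeg (allFin n) λ u → 0≤coefficient u (lookup κ u)) (characterSum-nonNeg G κ))

module _ {n} (G : Graph4 n) (w : Fin n → SignedPairing → ℚ) (v : Fin n) where

  vertexSum : (SignedPairing → ℚ) → ℚ
  vertexSum c = ∑ assignments λ s → ∑ orientations λ o → 𝟙 (IsDirected? G s o) * (c (lookup s v) * weight w s)

  Z≡vertexSum : ∀ ϱ → Z G w v ϱ ≡ vertexSum (λ x → 𝟙 (x ≟SP ϱ))
  Z≡vertexSum ϱ = begin
    Z G w v ϱ
      ≡⟨ ∑-filter at-v? (dacps G) (weight w ∘ proj₁) ⟩
    ∑ (dacps G) at-v
      ≡⟨ ∑-filter (IsDACP? G) pairs at-v ⟩
    ∑ pairs (λ p → 𝟙 (IsDACP? G p) * at-v p)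
      ≡⟨ ∑-cartesianProduct assignments orientations (λ p → 𝟙 (IsDACP? G p) * at-v p) ⟩
    ∑ assignments (λ s → ∑ orientations (λ o → 𝟙 (IsDACP? G (s , o)) * (𝟙 (lookup s v ≟SP ϱ) * weight w s)))
      ≡⟨ ∑-cong assignments (λ s → ∑-cong orientations (λ o → cong (_* (𝟙 (lookup s v ≟SP ϱ) * weight w s))
           (𝟙-cong (dacp⇔directed s o) (IsDACP? G (s , o)) (IsDirected? G s o)))) ⟩
    vertexSum (λ x → 𝟙 (x ≟SP ϱ)) ∎
    where
    open ≡-Reasoning
    pairs : List (Assignment n × Orientation n)
    pairs = cartesianProduct assignments orientations
    at-v? : ∀ (p : Assignment n × Orientation n) → Dec (lookup (proj₁ p) v ≡ ϱ)
    at-v? p = lookup (proj₁ p) v ≟SP ϱ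
    at-v : Assignment n × Orientation n → ℚ
    at-v p = 𝟙 (at-v? p) * weight w (proj₁ p)
    dacp⇔directed : ∀ s o → IsDACP G (s , o) ⇔ IsDirected G s o
    dacp⇔directed s o = mk⇔ proj₂ (λ directed → IsDirected⇒IsACP {G = G} {s} {o} directed , directed)

  vertexSum-+ : ∀ c c₁ c₂ → (∀ x → c x ≡ c₁ x + c₂ x) → vertexSum c ≡ vertexSum c₁ + vertexSum c₂
  vertexSum-+ c c₁ c₂ c≡c₁+c₂ = begin
    vertexSum c
      ≡⟨ ∑-cong assignments (λ s → ∑-cong orientations (λ o → split s o)) ⟩
    ∑ assignments (λ s → ∑ orientations (λ o → term c₁ s o + term c₂ s o))
      ≡⟨ ∑-cong assignments (λ s → ∑-distrib-+ orientations (term c₁ s) (term c₂ s)) ⟩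
    ∑ assignments (λ s → ∑ orientations (term c₁ s) + ∑ orientations (term c₂ s))
      ≡⟨ ∑-distrib-+ assignments (λ s → ∑ orientations (term c₁ s)) (λ s → ∑ orientations (term c₂ s)) ⟩
    vertexSum c₁ + vertexSum c₂ ∎
    where
    open ≡-Reasoning
    term : (SignedPairing → ℚ) → Assignment n → Orientation n → ℚ
    term c s o = 𝟙 (IsDirected? G s o) * (c (lookup s v) * weight w s)
    distribute : ∀ a b₁ b₂ x → a * ((b₁ + b₂) * x) ≡ a * (b₁ * x) + a * (b₂ * x)
    distribute = solve 4 (λ a b₁ b₂ x → a :* ((b₁ :+ b₂) :* x) := a :* (b₁ :* x) :+ a :* (b₂ :* x)) refl
    split : ∀ s o → term c s o ≡ term c₁ s o + term c₂ s o
    split s o = trans (cong (λ b → 𝟙 (IsDirected? G s o) * (b * weight w s)) (c≡c₁+c₂ (lookup s v)))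
                      (distribute (𝟙 (IsDirected? G s o)) (c₁ (lookup s v)) (c₂ (lookup s v)) (weight w s))

  twist : (SignedPairing → ℚ) → Fin n → SignedPairing → ℚ
  twist c = Vector.updateAt w v (λ wᵥ x → c x * wᵥ x)

  vertexSum≡partitionFunction : ∀ c → vertexSum c ≡ partitionFunction G (twist c)
  vertexSum≡partitionFunction c = ∑-cong assignments λ s → ∑-cong orientations λ o →
    cong (𝟙 (IsDirected? G s o) *_) (sym (twisted-weight s))
    where
    twisted-weight : ∀ s → ∏ (allFin n) (λ u → twist c u (lookup s u)) ≡ c (lookup s v) * weight w s
    twisted-weight s = ∏-allFin-scale n (λ u → w u (lookup s u)) (λ u → twist c u (lookup s u))
      v (c (lookup s v))
      (cong-app (VectorP.updateAt-updates v w) (lookup s v))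
      (λ u u≢v → cong-app (VectorP.updateAt-minimal u v w u≢v) (lookup s u))

  Z-difference : ∀ p → Z G w v ⟨ p ⟩₊ ≡ Z G w v ⟨ p ⟩₋ + partitionFunction G (twist (Δ p))
  Z-difference p = begin
    Z G w v ⟨ p ⟩₊
      ≡⟨ Z≡vertexSum ⟨ p ⟩₊ ⟩
    vertexSum δ₊
      ≡⟨ vertexSum-+ δ₊ δ₋ (Δ p) (λ x → add-difference (δ₊ x) (δ₋ x)) ⟩
    vertexSum δ₋ + vertexSum (Δ p)
      ≡⟨ cong₂ _+_ (sym (Z≡vertexSum ⟨ p ⟩₋)) (vertexSum≡partitionFunction (Δ p)) ⟩
    Z G w v ⟨ p ⟩₋ + partitionFunction G (twist (Δ p)) ∎
    where
    open ≡-Reasoning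
    δ₊ δ₋ : SignedPairing → ℚ
    δ₊ x = 𝟙 (x ≟SP ⟨ p ⟩₊)
    δ₋ x = 𝟙 (x ≟SP ⟨ p ⟩₋)
    add-difference : ∀ a b → a ≡ b + (a - b)
    add-difference = solve 2 (λ a b → a := b :+ (a :- b)) refl

  twist-coefficient-nonNeg : ∀ p → (∀ u ϱ → 0ℚ ≤ w u ϱ) → (∀ u → Dominant (w u)) →
    ∀ u k → 0ℚ ≤ coefficient (twist (Δ p) u) k
  twist-coefficient-nonNeg p 0≤w dominant u k with u FinP.≟ v
  ... | yes refl = subst (λ W → 0ℚ ≤ coefficient W k) (sym (VectorP.updateAt-updates v w))
    (coefficient-nonNeg (λ ϱ → Δ p ϱ * w v ϱ) (Δ-dominant p (0≤w v))
      (subst (0ℚ ≤_) (sym (∑-Δ p (w v))) (p≤q⇒0≤q-p (dominant v p))) k)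
  ... | no u≢v   = subst (λ W → 0ℚ ≤ coefficient W k) (sym (VectorP.updateAt-minimal u v w u≢v))
    (coefficient-nonNeg (w u) (dominant u) (∑-nonNeg allSP (0≤w u)) k)

-- Z does not involve a, b, c, d: their hypotheses only say that signature (w v) is the
-- eight-vertex function, which the argument never needs.
mainTheorem8 : (n : ℕ) (G : Graph4 n) (a b c d : Fin n → ℚ)
    (w : Fin n → SignedPairing → ℚ) →
    (∀ v → 0ℚ ≤ a v × 0ℚ ≤ b v × 0ℚ ≤ c v × 0ℚ ≤ d v) →
    (∀ v ϱ → 0ℚ ≤ w v ϱ) →
    (∀ v → a v ≡ w v ⟨ zero ⟩₋ + w v ⟨ suc zero ⟩₊ + w v ⟨ suc (suc zero) ⟩₊) →
    (∀ v → b v ≡ w v ⟨ zero ⟩₊ + w v ⟨ suc zero ⟩₋ + w v ⟨ suc (suc zero) ⟩₊) →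
    (∀ v → c v ≡ w v ⟨ zero ⟩₊ + w v ⟨ suc zero ⟩₊ + w v ⟨ suc (suc zero) ⟩₋) →
    (∀ v → d v ≡ w v ⟨ zero ⟩₋ + w v ⟨ suc zero ⟩₋ + w v ⟨ suc (suc zero) ⟩₋) →
    (∀ v (p : Fin 3) → w v ⟨ p ⟩₋ ≤ w v ⟨ p ⟩₊) →
    ∀ v (p : Fin 3) → Z G w v ⟨ p ⟩₋ ≤ Z G w v ⟨ p ⟩₊
mainTheorem8 n G a b c d w _ 0≤w _ _ _ _ dominant v p = begin
  Z G w v ⟨ p ⟩₋                                ≤⟨ p≤p+q (partitionFunction-nonNeg G twisted 0≤coefficients) ⟩
  Z G w v ⟨ p ⟩₋ + partitionFunction G twisted  ≡⟨ sym (Z-difference G w v p) ⟩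
  Z G w v ⟨ p ⟩₊                                ∎
  where
  open ℚP.≤-Reasoning
  twisted : Fin n → SignedPairing → ℚ
  twisted = twist G w v (Δ p)
  0≤coefficients : ∀ u k → 0ℚ ≤ coefficient (twisted u) k
  0≤coefficients = twist-coefficient-nonNeg G w v p 0≤w dominant
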